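{- Let $\mathcal{P}$ be a hereditary class of binary matroids, let $N\in\mathcal{P}$ and let $t\ge 0$. Suppose that for every $M=(E,G)\in\mathcal{P}$ having a hyperplane $H$ of $G$ with $M|H\cong N$ and $|E\setminus H|>0$, we have $|E\setminus H|>t$. Then for every $k\ge 0$ and every $M=(E,G)\in\mathcal{P}$ having a hyperplane $H$ with $M|H\cong D^k(N)$ and $|E\setminus H|>0$, we have $|E\setminus H|>t\cdot 2^k$.
   Context: A (simple binary) matroid is a pair $M=(E,G)$ where $G$ is a finite binary projective geometry identified with $\mathbb{F}_2^n\setminus\{0\}$ and $E\subseteq G$. A flat is a set $F\subseteq G$ with $F\cup\{0\}$ a subspace; a hyperplane is a maximal proper flat; $M|F=(E\cap F,F)$ is an induced restriction; isomorphism is an isomorphism of geometries carrying ground set to ground set. A class $\mathcal{P}$ is hereditary if it is closed under taking induced restrictions (and isomorphism). Doubling: if $H$ is a hyperplane of $G$ and $a\in G\setminus H$ with $E=(E\cap H)\cup(a+(E\cap H))$, then $M$ is the doubling of $M|H$; $D(N)$ denotes the doubling of $N$ (unique up to isomorphism), $D^k(N)=D(D^{k-1}(N))$, $D^0(N)=N$. -}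

module Defs where

open import Data.Nat using (ℕ; zero; suc; _+_)
open import Data.Bool using (Bool; true; false; _xor_; _∧_; not)
open import Data.Vec using (Vec; []; _∷_; replicate; zipWith)
open import Data.List using (List; []; _∷_; map; _++_; length; filterᵇ)
open import Data.Product using (Σ; ∃; _×_; _,_)
open import Data.Sum using (_⊎_)
open import Relation.Binary.PropositionalEquality using (_≡_; _≢_)
open import Relation.Nullary using (¬_)

-- Points of F₂ⁿ are Boolean vectors; the projective geometry G is F₂ⁿ ∖ {0}.
V : ℕ → Set
V n = Vec Bool n

𝟎 : ∀ {n} → V n
𝟎 {n} = replicate n false

_⊕_ : ∀ {n} → V n → V n → V n
_⊕_ = zipWith _xor_

Subset : ℕ → Set
Subset n = V n → Bool

_∈_ : ∀ {n} → V n → Subset n → Set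
x ∈ S = S x ≡ true

-- A simple binary matroid M = (E, G) with G = F₂ⁿ ∖ {0}: E ⊆ G.
record Matroid (n : ℕ) : Set where
  field
    E     : Subset n
    E-0∉ : E 𝟎 ≡ false
open Matroid public

-- Flat: F ⊆ G with F ∪ {0} a subspace.
IsFlat : ∀ {n} → Subset n → Set
IsFlat {n} F = (F 𝟎 ≡ false) × (∀ (x y : V n) → x ∈ F → y ∈ F → x ≢ y → (x ⊕ y) ∈ F)

IsHyperplane : ∀ {n} → Subset n → Set
IsHyperplane {n} H =
  IsFlat H
  × (Σ (V n) λ x → (x ≢ 𝟎) × (H x ≡ false))
  × (∀ (F : Subset n) → IsFlat F → (∀ x → x ∈ H → x ∈ F) →
       (∀ x → x ≢ 𝟎 → x ∈ F) ⊎ (∀ x → F x ≡ H x))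

-- M|F ≅ N : an isomorphism of geometries (over F₂ : an injective linear map
-- F₂ᵐ → F₂ⁿ whose image of the nonzero vectors is exactly F) carrying the
-- ground set of N onto E ∩ F.
RestrIso : ∀ {n m} → Matroid n → Subset n → Matroid m → Set
RestrIso {n} {m} M F N =
  Σ (V m → V n) λ f →
    (∀ x y → f (x ⊕ y) ≡ f x ⊕ f y)
    × (∀ x y → f x ≡ f y → x ≡ y)
    × (∀ y → y ∈ F → Σ (V m) λ x → (x ≢ 𝟎) × (f x ≡ y))
    × (∀ x → x ≢ 𝟎 → f x ∈ F)
    × (∀ x → E N x ≡ (E M (f x) ∧ F (f x)))

-- Hereditary: closed under induced restrictions and isomorphism.
Hereditary : (P : ∀ n → Matroid n → Set) → Set
Hereditary P = ∀ n m (M : Matroid n) (F : Subset n) (N : Matroid m) →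
  P n M → IsFlat F → RestrIso M F N → P m N

-- Doubling: D(N) on F₂^{m+1}, with hyperplane {first coordinate = 0} and a = (1,0,…,0).
D : ∀ {m} → Matroid m → Matroid (suc m)
D {m} N = record { E = E' ; E-0∉ = E-0∉ N }
  where
  E' : Subset (suc m)
  E' (false ∷ v) = E N v
  E' (true ∷ v) = E N v

Dᵏ : ∀ {m} (k : ℕ) → Matroid m → Matroid (k + m)
Dᵏ zero N = N
Dᵏ (suc k) N = D (Dᵏ k N)

allV : (n : ℕ) → List (V n)
allV zero = [] ∷ []
allV (suc n) = map (false ∷_) (allV n) ++ map (true ∷_) (allV n)

count : ∀ {n} → Subset n → ℕ
count {n} S = length (filterᵇ S (allV n))

outside : ∀ {n} → Matroid n → Subset n → ℕ
outside M H = count (λ x → E M x ∧ not (H x))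

{-# OPTIONS --safe #-}
module Submission where

-- Both hypothesis and conclusion are bounds on extensions. A hyperplane H with M|H ≅ Q can be
-- moved to the coordinate hyperplane H₀ = {x₀ = 0} by restricting M along an isomorphism, so it
-- suffices to show: if every extension of Q in 𝒫 that adds points outside H₀ adds more than s of
-- them, then every such extension of D(Q) adds more than 2s. Write the added points as (1, b, v).
-- For a linear form φ and c ∈ F₂, the vectors (0, φ v, v) and (1, c, 0) span a hyperplane on which
-- M restricts to an extension of Q (membership in D(Q) ignores b), so the coset {b = φ v + c} of
-- the added points is empty or has more than s elements. If s > 0, some slice {b = c} has two
-- points; taking for φ a coordinate that separates them makes both cosets non-empty, whence more
-- than 2s points in total.

open import Defs
open import Algebra.Bundles using (AbelianGroup)
open import Algebra.Structures using (IsAbelianGroup)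
import Algebra.Properties.CommutativeSemigroup as CommutativeSemigroupProperties
import Algebra.Properties.Group as GroupProperties
open import Data.Bool using (Bool; true; false; _∧_; _∨_; _xor_; not; T)
open import Data.Bool.ListAction using (any)
open import Data.Bool.Properties
  using (_≟_; T-≡; ∧-comm; ∧-identityʳ; ∧-zeroʳ; ∨-comm; xor-assoc; xor-comm; xor-identityˡ; xor-identityʳ; xor-same)
open import Data.Empty using (⊥-elim)
open import Data.Fin using (Fin; zero; suc)
open import Data.List using (List; []; _∷_; map; _++_; length; filterᵇ)
open import Data.List.Membership.Propositional using () renaming (_∈_ to _∈ˡ_)
open import Data.List.Membership.Propositional.Properties
  using (∈-filter⁺; ∈-filter⁻; ∈-map⁺; ∈-map⁻; ∈-++⁺ˡ; ∈-++⁺ʳ; ∈-++⁻; ∈-∃++; ∈-length)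
open import Data.List.Properties using (length-++; length-filter; filter-++; filter-≐; filter-none)
open import Data.List.Relation.Unary.All using () renaming ([] to []ᴬ; lookup to lookupᴬ; tabulate to tabulateᴬ)
open import Data.List.Relation.Unary.AllPairs using ([]; _∷_)
open import Data.List.Relation.Unary.Any as Any using (here; there; satisfied)
open import Data.List.Relation.Unary.Any.Properties using (any⁺; any⁻)
open import Data.List.Relation.Unary.Unique.Propositional using (Unique)
import Data.List.Relation.Unary.Unique.Propositional.Properties as UniqueProperties
open import Data.Nat using (ℕ; zero; suc; _+_; _*_; _^_; _<_; _≤_; z≤n; s≤s)
open import Data.Nat.Properties
  using (+-suc; +-identityʳ; *-identityʳ; *-distribˡ-+; ≤-trans; <-≤-trans; +-mono-<; module ≤-Reasoning)
open import Data.Product using (Σ; ∃; _×_; _,_; proj₁; proj₂)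
open import Data.Sum using (_⊎_; inj₁; inj₂)
open import Data.Vec using ([]; _∷_; lookup; tail)
open import Data.Vec.Properties
  using (≡-dec; lookup-zipWith; zipWith-assoc; zipWith-comm; zipWith-identityˡ; zipWith-identityʳ)
open import Function using (_∘_; id; Equivalence)
open import Level using (0ℓ)
open import Relation.Binary.Definitions using (DecidableEquality)
open import Relation.Binary.PropositionalEquality
open import Relation.Nullary using (¬_)
open import Relation.Nullary.Decidable using (yes; no; does; dec-true; dec-false; T?)

T⇒≡ : ∀ {b} → T b → b ≡ true
T⇒≡ = Equivalence.to T-≡

≡⇒T : ∀ {b} → b ≡ true → T b
≡⇒T = Equivalence.from T-≡

implication⇒∧≡ : ∀ {a b} → (a ≡ true → b ≡ true) → a ∧ b ≡ a
implication⇒∧≡ {false} _ = refl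
implication⇒∧≡ {true} a⇒b = a⇒b refl

∧-not≡true : ∀ {a b} → a ∧ not b ≡ true → a ≡ true × b ≡ false
∧-not≡true {true} {false} _ = refl , refl

xor-cancelʳ : ∀ a b → (a xor b) xor b ≡ a
xor-cancelʳ a b = trans (xor-assoc a b b) (trans (cong (a xor_) (xor-same b)) (xor-identityʳ a))

⊕-self : ∀ {n} (x : V n) → x ⊕ x ≡ 𝟎
⊕-self [] = refl
⊕-self (b ∷ x) = cong₂ _∷_ (xor-same b) (⊕-self x)

⊕-isAbelianGroup : ∀ n → IsAbelianGroup _≡_ (_⊕_ {n}) 𝟎 id
⊕-isAbelianGroup n = record
  { isGroup = record
    { isMonoid = record
      { isSemigroup = record
        { isMagma = record { isEquivalence = isEquivalence ; ∙-cong = cong₂ _⊕_ }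
        ; assoc = zipWith-assoc xor-assoc
        }
      ; identity = zipWith-identityˡ xor-identityˡ , zipWith-identityʳ xor-identityʳ
      }
    ; inverse = ⊕-self , ⊕-self
    ; ⁻¹-cong = id
    }
  ; comm = zipWith-comm xor-comm
  }

⊕-abelianGroup : ℕ → AbelianGroup 0ℓ 0ℓ
⊕-abelianGroup n = record { isAbelianGroup = ⊕-isAbelianGroup n }

open module ⊕-Group {n : ℕ} = AbelianGroup (⊕-abelianGroup n)
  using () renaming (assoc to ⊕-assoc; identityʳ to ⊕-identityʳ)
open module ⊕-GroupProperties {n : ℕ} = GroupProperties (AbelianGroup.group (⊕-abelianGroup n))
  using () renaming (\\-leftDividesˡ to ⊕-cancelˡ; x∙y⁻¹≈ε⇒x≈y to ⊕≡𝟎⇒≡)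
open module ⊕-CommutativeSemigroupProperties {n : ℕ} =
  CommutativeSemigroupProperties (AbelianGroup.commutativeSemigroup (⊕-abelianGroup n))
  using (interchange; xy∙z≈xz∙y)

_≟ᵥ_ : ∀ {n} → DecidableEquality (V n)
_≟ᵥ_ = ≡-dec _≟_

Linear : ∀ {p n} → (V p → V n) → Set
Linear f = ∀ x y → f (x ⊕ y) ≡ f x ⊕ f y

linear-𝟎 : ∀ {p n} {f : V p → V n} → Linear f → f 𝟎 ≡ 𝟎
linear-𝟎 {f = f} f-linear = begin
  f 𝟎           ≡⟨ cong f (⊕-self 𝟎) ⟨
  f (𝟎 ⊕ 𝟎)     ≡⟨ f-linear 𝟎 𝟎 ⟩
  f 𝟎 ⊕ f 𝟎     ≡⟨ ⊕-self (f 𝟎) ⟩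
  𝟎             ∎
  where open ≡-Reasoning

trivial-kernel⇒injective : ∀ {p n} {f : V p → V n} → Linear f → (∀ x → f x ≡ 𝟎 → x ≡ 𝟎) →
  ∀ {x y} → f x ≡ f y → x ≡ y
trivial-kernel⇒injective {f = f} f-linear kernel {x} {y} fx≡fy =
  ⊕≡𝟎⇒≡ x y (kernel (x ⊕ y) (trans (f-linear x y) (trans (cong (_⊕ f y) fx≡fy) (⊕-self (f y)))))

record LinearEmbedding (p n : ℕ) : Set where
  field
    to        : V p → V n
    linear    : Linear to
    injective : ∀ {x y} → to x ≡ to y → x ≡ y

open LinearEmbedding public

adjoin : ∀ {q n} (f : LinearEmbedding q n) (a : V n) → (∀ v → to f v ≢ a) → LinearEmbedding (suc q) n
adjoin {q} {n} f a a∉f = record { to = g ; linear = g-linear ; injective = trivial-kernel⇒injective g-linear kernel }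
  where
  g : V (suc q) → V n
  g (false ∷ v) = to f v
  g (true ∷ v) = to f v ⊕ a

  g-linear : Linear g
  g-linear (false ∷ x) (false ∷ y) = linear f x y
  g-linear (false ∷ x) (true ∷ y) = trans (cong (_⊕ a) (linear f x y)) (⊕-assoc (to f x) (to f y) a)
  g-linear (true ∷ x) (false ∷ y) = trans (cong (_⊕ a) (linear f x y)) (xy∙z≈xz∙y (to f x) (to f y) a)
  g-linear (true ∷ x) (true ∷ y) = begin
    to f (x ⊕ y)                        ≡⟨ linear f x y ⟩
    to f x ⊕ to f y                     ≡⟨ ⊕-identityʳ _ ⟨
    (to f x ⊕ to f y) ⊕ 𝟎               ≡⟨ cong ((to f x ⊕ to f y) ⊕_) (⊕-self a) ⟨
    (to f x ⊕ to f y) ⊕ (a ⊕ a)         ≡⟨ interchange (to f x) (to f y) a a ⟩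
    (to f x ⊕ a) ⊕ (to f y ⊕ a)         ∎
    where open ≡-Reasoning

  kernel : ∀ x → g x ≡ 𝟎 → x ≡ 𝟎
  kernel (false ∷ v) fv≡𝟎 = cong (false ∷_) (injective f (trans fv≡𝟎 (sym (linear-𝟎 (linear f)))))
  kernel (true ∷ v) fv⊕a≡𝟎 = ⊥-elim (a∉f v (⊕≡𝟎⇒≡ (to f v) a fv⊕a≡𝟎))

injection-length-≤ : ∀ {A B : Set} (f : A → B) → (∀ {x y} → f x ≡ f y → x ≡ y) →
  ∀ {xs} → Unique xs → (ys : List B) → (∀ {x} → x ∈ˡ xs → f x ∈ˡ ys) → length xs ≤ length ys
injection-length-≤ f f-inj {[]} _ ys _ = z≤n
injection-length-≤ f f-inj {x ∷ xs} (x∉xs ∷ xs-unique) ys xs⊆ys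
  with ys₁ , ys₂ , refl ← ∈-∃++ (xs⊆ys (here refl)) = begin
    suc (length xs)              ≤⟨ s≤s (injection-length-≤ f f-inj xs-unique (ys₁ ++ ys₂) xs⊆ys₁++ys₂) ⟩
    suc (length (ys₁ ++ ys₂))    ≡⟨ cong suc (length-++ ys₁) ⟩
    suc (length ys₁ + length ys₂) ≡⟨ +-suc (length ys₁) (length ys₂) ⟨
    length ys₁ + length (f x ∷ ys₂) ≡⟨ length-++ ys₁ ⟨
    length (ys₁ ++ f x ∷ ys₂)    ∎
  where
  open ≤-Reasoning
  xs⊆ys₁++ys₂ : ∀ {y} → y ∈ˡ xs → f y ∈ˡ ys₁ ++ ys₂
  xs⊆ys₁++ys₂ {y} y∈xs with ∈-++⁻ ys₁ (xs⊆ys (there y∈xs))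
  ... | inj₁ ∈ys₁ = ∈-++⁺ˡ ∈ys₁
  ... | inj₂ (here fy≡fx) = ⊥-elim (lookupᴬ x∉xs y∈xs (sym (f-inj fy≡fx)))
  ... | inj₂ (there ∈ys₂) = ∈-++⁺ʳ ys₁ ∈ys₂

length-filterᵇ-map : ∀ {A B : Set} (p : B → Bool) (f : A → B) xs →
  length (filterᵇ p (map f xs)) ≡ length (filterᵇ (p ∘ f) xs)
length-filterᵇ-map p f [] = refl
length-filterᵇ-map p f (x ∷ xs) with p (f x)
... | true = cong suc (length-filterᵇ-map p f xs)
... | false = length-filterᵇ-map p f xs

length-filterᵇ-∨-∧ : ∀ {A : Set} (p q : A → Bool) xs →
  length (filterᵇ p xs) + length (filterᵇ q xs)
    ≡ length (filterᵇ (λ x → p x ∨ q x) xs) + length (filterᵇ (λ x → p x ∧ q x) xs)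
length-filterᵇ-∨-∧ p q [] = refl
length-filterᵇ-∨-∧ p q (x ∷ xs) with p x | q x
... | true | true = cong suc (trans (+-suc _ _) (trans (cong suc (length-filterᵇ-∨-∧ p q xs)) (sym (+-suc _ _))))
... | true | false = cong suc (length-filterᵇ-∨-∧ p q xs)
... | false | true = trans (+-suc _ _) (cong suc (length-filterᵇ-∨-∧ p q xs))
... | false | false = length-filterᵇ-∨-∧ p q xs

∈-allV : ∀ {n} (v : V n) → v ∈ˡ allV n
∈-allV [] = here refl
∈-allV {suc n} (false ∷ v) = ∈-++⁺ˡ (∈-map⁺ (false ∷_) (∈-allV v))
∈-allV {suc n} (true ∷ v) = ∈-++⁺ʳ (map (false ∷_) (allV n)) (∈-map⁺ (true ∷_) (∈-allV v))

allV-unique : ∀ n → Unique (allV n)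
allV-unique zero = []ᴬ ∷ []
allV-unique (suc n) =
  UniqueProperties.++⁺ (UniqueProperties.map⁺ (cong tail) (allV-unique n))
    (UniqueProperties.map⁺ (cong tail) (allV-unique n)) disjoint
  where
  disjoint : ∀ {v} → ¬ (v ∈ˡ map (false ∷_) (allV n) × v ∈ˡ map (true ∷_) (allV n))
  disjoint (v∈₀ , v∈₁) with ∈-map⁻ (false ∷_) v∈₀ | ∈-map⁻ (true ∷_) v∈₁
  ... | _ , _ , refl | _ , _ , ()

count-cong : ∀ {n} {S S′ : Subset n} → (∀ x → S x ≡ S′ x) → count S ≡ count S′
count-cong {n} {S} {S′} S≗S′ =
  cong length (filter-≐ (T? ∘ S) (T? ∘ S′) (subst T (S≗S′ _) , subst T (sym (S≗S′ _))) (allV n))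

count-split : ∀ {n} (S : Subset (suc n)) → count S ≡ count (S ∘ (false ∷_)) + count (S ∘ (true ∷_))
count-split {n} S = begin
  length (filterᵇ S (map (false ∷_) (allV n) ++ map (true ∷_) (allV n)))
    ≡⟨ cong length (filter-++ (T? ∘ S) (map (false ∷_) (allV n)) (map (true ∷_) (allV n))) ⟩
  length (filterᵇ S (map (false ∷_) (allV n)) ++ filterᵇ S (map (true ∷_) (allV n)))
    ≡⟨ length-++ (filterᵇ S (map (false ∷_) (allV n))) ⟩
  length (filterᵇ S (map (false ∷_) (allV n))) + length (filterᵇ S (map (true ∷_) (allV n)))
    ≡⟨ cong₂ _+_ (length-filterᵇ-map S _ (allV n)) (length-filterᵇ-map S _ (allV n)) ⟩
  count (S ∘ (false ∷_)) + count (S ∘ (true ∷_)) ∎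
  where open ≡-Reasoning

count-pos : ∀ {n} (S : Subset n) {v} → v ∈ S → 0 < count S
count-pos S {v} v∈S = ∈-length (∈-filter⁺ (T? ∘ S) (∈-allV v) (≡⇒T v∈S))

count-pos⁻ : ∀ {n} (S : Subset n) → 0 < count S → ∃ λ v → v ∈ S
count-pos⁻ {n} S pos with filterᵇ S (allV n) in eq
... | v ∷ _ = v , T⇒≡ (proj₂ (∈-filter⁻ (T? ∘ S) {xs = allV n} (subst (v ∈ˡ_) (sym eq) (here refl))))

count-none : ∀ {n} {S : Subset n} → (∀ v → S v ≡ false) → count S ≡ 0
count-none {n} {S} S-empty =
  cong length (filter-none (T? ∘ S) {xs = allV n} (tabulateᴬ λ {v} _ → subst T (S-empty v)))

nonempty? : ∀ {n} (S : Subset n) → (∃ λ v → v ∈ S) ⊎ (∀ v → S v ≡ false)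
nonempty? S with count S in eq
... | suc _ = inj₁ (count-pos⁻ S (subst (0 <_) (sym eq) (s≤s z≤n)))
... | zero = inj₂ λ v → ∉ v
  where
  ∉ : ∀ v → S v ≡ false
  ∉ v with S v in v∈S
  ... | false = refl
  ... | true with () ← subst (0 <_) eq (count-pos S v∈S)

count-∨-∧ : ∀ {n} (S S′ : Subset n) →
  count S + count S′ ≡ count (λ x → S x ∨ S′ x) + count (λ x → S x ∧ S′ x)
count-∨-∧ {n} S S′ = length-filterᵇ-∨-∧ S S′ (allV n)

count-mono-injective : ∀ {p n} {S : Subset p} {S′ : Subset n} (f : V p → V n) →
  (∀ {x y} → f x ≡ f y → x ≡ y) → (∀ x → x ∈ S → f x ∈ S′) → count S ≤ count S′
count-mono-injective {p} {n} {S} {S′} f f-inj f-maps =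
  injection-length-≤ f f-inj (UniqueProperties.filter⁺ (T? ∘ S) (allV-unique p)) (filterᵇ S′ (allV n))
    λ {x} x∈ → ∈-filter⁺ (T? ∘ S′) (∈-allV (f x))
      (≡⇒T (f-maps x (T⇒≡ (proj₂ (∈-filter⁻ (T? ∘ S) {xs = allV p} x∈)))))

Separates : ∀ {n} → Subset n → Fin n → Set
Separates {n} S i = ∀ b → Σ (V n) λ v → v ∈ S × lookup v i ≡ b

Separates-∷ : ∀ {n} {S : Subset (suc n)} {i} c → Separates (S ∘ (c ∷_)) i → Separates S (suc i)
Separates-∷ c sep b with v , v∈S , vᵢ≡b ← sep b = c ∷ v , v∈S , vᵢ≡b

separating-coordinate : ∀ {n} (S : Subset n) → 2 ≤ count S → Σ (Fin n) (Separates S)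
separating-coordinate {zero} S 2≤count with s≤s () ← ≤-trans 2≤count (length-filter (T? ∘ S) (allV 0))
separating-coordinate {suc n} S 2≤count with nonempty? (S ∘ (false ∷_)) | nonempty? (S ∘ (true ∷_))
... | inj₁ (v , v∈S) | inj₁ (w , w∈S) =
  zero , λ { false → false ∷ v , v∈S , refl ; true → true ∷ w , w∈S , refl }
... | inj₂ S₀-empty | _ =
  let i , sep = separating-coordinate (S ∘ (true ∷_))
        (subst (2 ≤_) (trans (count-split S) (cong (_+ count (S ∘ (true ∷_))) (count-none S₀-empty))) 2≤count)
  in suc i , Separates-∷ true sep
... | inj₁ _ | inj₂ S₁-empty =
  let i , sep = separating-coordinate (S ∘ (false ∷_))
        (subst (2 ≤_) (trans (count-split S)
          (trans (cong (count (S ∘ (false ∷_)) +_) (count-none S₁-empty)) (+-identityʳ _))) 2≤count)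
  in suc i , Separates-∷ false sep

∈E⇒≢𝟎 : ∀ {n} (M : Matroid n) {y} → y ∈ E M → y ≢ 𝟎
∈E⇒≢𝟎 M y∈E refl = true≢false (trans (sym y∈E) (E-0∉ M))
  where
  true≢false : true ≢ false
  true≢false ()

image : ∀ {p n} → LinearEmbedding p n → Subset n
image {p} f y = any (λ x → not (does (x ≟ᵥ 𝟎)) ∧ does (to f x ≟ᵥ y)) (allV p)

module _ {p n} (f : LinearEmbedding p n) where

  image-sound : ∀ {y} → y ∈ image f → Σ (V p) λ x → (x ≢ 𝟎) × (to f x ≡ y)
  image-sound {y} y∈f with satisfied (any⁻ _ (allV p) (≡⇒T y∈f))
  ... | x , _ with x ≟ᵥ 𝟎 | to f x ≟ᵥ y
  -- in the omitted cases the discarded witness has type T false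
  ...   | no x≢𝟎 | yes fx≡y = x , x≢𝟎 , fx≡y

  image-complete : ∀ {x} → x ≢ 𝟎 → to f x ∈ image f
  image-complete {x} x≢𝟎 = T⇒≡ (any⁺ _ (Any.map (λ { refl → ≡⇒T x-witnesses }) (∈-allV x)))
    where
    x-witnesses : not (does (x ≟ᵥ 𝟎)) ∧ does (to f x ≟ᵥ to f x) ≡ true
    x-witnesses = cong₂ (λ a b → not a ∧ b) (dec-false (x ≟ᵥ 𝟎) x≢𝟎) (dec-true (to f x ≟ᵥ to f x) refl)

  image-∉ : ∀ {y} → (∀ x → x ≢ 𝟎 → to f x ≢ y) → image f y ≡ false
  image-∉ {y} y∉ with image f y in y∈f
  ... | false = refl
  ... | true with x , x≢𝟎 , fx≡y ← image-sound y∈f = ⊥-elim (y∉ x x≢𝟎 fx≡y)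

  image-isFlat : IsFlat (image f)
  image-isFlat = image-∉ 𝟎∉ , closed
    where
    𝟎∉ : ∀ x → x ≢ 𝟎 → to f x ≢ 𝟎
    𝟎∉ x x≢𝟎 fx≡𝟎 = x≢𝟎 (injective f (trans fx≡𝟎 (sym (linear-𝟎 (linear f)))))
    closed : ∀ x y → x ∈ image f → y ∈ image f → x ≢ y → (x ⊕ y) ∈ image f
    closed x y x∈f y∈f x≢y with a , _ , refl ← image-sound x∈f | b , _ , refl ← image-sound y∈f =
      subst (_∈ image f) (linear f a b) (image-complete (λ a⊕b≡𝟎 → x≢y (cong (to f) (⊕≡𝟎⇒≡ a b a⊕b≡𝟎))))

restrict : ∀ {p n} → Matroid n → LinearEmbedding p n → Matroid p
restrict M f = record { E = E M ∘ to f ; E-0∉ = trans (cong (E M) (linear-𝟎 (linear f))) (E-0∉ M) }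

image-restrIso : ∀ {p n} (M : Matroid n) (f : LinearEmbedding p n) (Q : Matroid p) →
  (∀ x → E Q x ≡ E M (to f x)) → RestrIso M (image f) Q
image-restrIso M f Q Q≗M∘f =
  to f , linear f , (λ _ _ → injective f) , (λ _ → image-sound f) , (λ _ → image-complete f) ,
  λ x → trans (Q≗M∘f x) (sym (implication⇒∧≡ λ fx∈E →
    image-complete f λ { refl → ∈E⇒≢𝟎 M fx∈E (linear-𝟎 (linear f)) }))

restrict-∈ : ∀ {P : ∀ n → Matroid n → Set} → Hereditary P →
  ∀ {p n} {M : Matroid n} → P n M → (f : LinearEmbedding p n) → P p (restrict M f)
restrict-∈ hereditary {p} {n} {M} M∈P f =
  hereditary n p M (image f) (restrict M f) M∈P (image-isFlat f) (image-restrIso M f (restrict M f) λ _ → refl)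

restrIso-embedding : ∀ {n q} {M : Matroid n} {F : Subset n} {Q : Matroid q} →
  RestrIso M F Q → LinearEmbedding q n
restrIso-embedding (f , f-linear , f-injective , _) =
  record { to = f ; linear = f-linear ; injective = f-injective _ _ }

restrIso-ground : ∀ {n q} {M : Matroid n} {F : Subset n} {Q : Matroid q} (iso : RestrIso M F Q) →
  ∀ v → E Q v ≡ E M (proj₁ iso v)
restrIso-ground {M = M} (f , f-linear , _ , _ , f-into , Q≗M∧F) v =
  trans (Q≗M∧F v) (implication⇒∧≡ λ fv∈E → f-into v λ { refl → ∈E⇒≢𝟎 M fv∈E (linear-𝟎 f-linear) })

hyperplane-maximal : ∀ {n} {H F : Subset n} → IsHyperplane H → IsFlat F → (∀ x → x ∈ H → x ∈ F) →
  ∀ {y} → y ∈ F → H y ≡ false → ∀ x → x ≢ 𝟎 → x ∈ F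
hyperplane-maximal (_ , _ , maximal) F-flat H⊆F {y} y∈F y∉H with maximal _ F-flat H⊆F
... | inj₁ F-full = F-full
... | inj₂ F≗H with () ← trans (sym y∈F) (trans (F≗H y) y∉H)

ι₀ : ∀ {q} → LinearEmbedding q (suc q)
ι₀ = record { to = false ∷_ ; linear = λ _ _ → refl ; injective = cong tail }

H₀ : ∀ {q} → Subset (suc q)
H₀ = image ι₀

H₀-true : ∀ {q} (v : V q) → H₀ (true ∷ v) ≡ false
H₀-true {q} v = image-∉ (ι₀ {q}) {true ∷ v} λ _ _ ()

H₀-false : ∀ {q} {v : V q} → v ≢ 𝟎 → H₀ (false ∷ v) ≡ true
H₀-false {q} = image-complete (ι₀ {q})

H₀-isHyperplane : ∀ {q} → IsHyperplane (H₀ {q})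
H₀-isHyperplane {q} = image-isFlat (ι₀ {q}) , (true ∷ 𝟎 , (λ ()) , H₀-true {q} 𝟎) , maximal
  where
  maximal : ∀ F → IsFlat F → (∀ x → x ∈ H₀ → x ∈ F) → (∀ x → x ≢ 𝟎 → x ∈ F) ⊎ (∀ x → F x ≡ H₀ x)
  maximal F (F-𝟎 , F-closed) H₀⊆F with nonempty? (F ∘ (true ∷_))
  ... | inj₁ (u , u∈F) = inj₁ full
    where
    full : ∀ x → x ≢ 𝟎 → x ∈ F
    full (false ∷ w) w≢𝟎 = H₀⊆F _ (H₀-false (w≢𝟎 ∘ cong (false ∷_)))
    full (true ∷ w) _ with w ≟ᵥ u
    ... | yes refl = u∈F
    ... | no w≢u = subst (_∈ F) (cong (true ∷_) (⊕-cancelˡ u w))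
      (F-closed (true ∷ u) (false ∷ (u ⊕ w)) u∈F (H₀⊆F _ (H₀-false (w≢u ∘ sym ∘ ⊕≡𝟎⇒≡ u w))) λ ())
  ... | inj₂ F₁-empty = inj₂ F≗H₀
    where
    F≗H₀ : ∀ x → F x ≡ H₀ x
    F≗H₀ (true ∷ w) = trans (F₁-empty w) (sym (H₀-true w))
    F≗H₀ (false ∷ w) with w ≟ᵥ 𝟎
    ... | yes refl = trans F-𝟎 (sym (proj₁ (image-isFlat (ι₀ {q}))))
    ... | no w≢𝟎 = trans (H₀⊆F _ (H₀-false w≢𝟎)) (sym (H₀-false w≢𝟎))

Extends : ∀ {q} → Matroid (suc q) → Matroid q → Set
Extends M Q = ∀ v → E M (false ∷ v) ≡ E Q v

outside₀ : ∀ {q} → Matroid (suc q) → ℕ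
outside₀ M = count (λ v → E M (true ∷ v))

outside-H₀ : ∀ {q} (M : Matroid (suc q)) → outside M H₀ ≡ outside₀ M
outside-H₀ M =
  trans (count-split (λ x → E M x ∧ not (H₀ x))) (cong₂ _+_ (count-none nothing-in-H₀) (count-cong everything-off-H₀))
  where
  nothing-in-H₀ : ∀ v → E M (false ∷ v) ∧ not (H₀ (false ∷ v)) ≡ false
  nothing-in-H₀ v with v ≟ᵥ 𝟎
  ... | yes refl = cong (_∧ _) (E-0∉ M)
  ... | no v≢𝟎 = trans (cong (λ b → E M (false ∷ v) ∧ not b) (H₀-false v≢𝟎)) (∧-zeroʳ _)
  everything-off-H₀ : ∀ v → E M (true ∷ v) ∧ not (H₀ (true ∷ v)) ≡ E M (true ∷ v)
  everything-off-H₀ v = trans (cong (λ b → E M (true ∷ v) ∧ not b) (H₀-true v)) (∧-identityʳ _)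

HyperplaneBound : (P : ∀ n → Matroid n → Set) → ∀ {q} → Matroid q → ℕ → Set
HyperplaneBound P Q s = ∀ n (M : Matroid n) (H : Subset n) → P n M → IsHyperplane H →
  RestrIso M H Q → 0 < outside M H → s < outside M H

ExtensionBound : (P : ∀ n → Matroid n → Set) → ∀ {q} → Matroid q → ℕ → Set
ExtensionBound P {q} Q s = ∀ (M : Matroid (suc q)) → P (suc q) M → Extends M Q →
  0 < outside₀ M → s < outside₀ M

module _ {P : ∀ n → Matroid n → Set} {q} {Q : Matroid q} {s : ℕ} where

  hyperplane⇒extension : HyperplaneBound P Q s → ExtensionBound P Q s
  hyperplane⇒extension bound M M∈P M-extends pos =
    subst (s <_) (outside-H₀ M)
      (bound _ M H₀ M∈P H₀-isHyperplane (image-restrIso M ι₀ Q (sym ∘ M-extends))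
        (subst (0 <_) (sym (outside-H₀ M)) pos))

  extension⇒hyperplane : Hereditary P → ExtensionBound P Q s → HyperplaneBound P Q s
  extension⇒hyperplane hereditary bound n M H M∈P H-hyperplane@(_ , (e , e≢𝟎 , e∉H) , _)
    iso@(_ , _ , _ , f-onto , f-into , _) pos =
    <-≤-trans (bound (restrict M g) (restrict-∈ hereditary M∈P g) g-extends (g-positive pos)) g-outside≤outside
    where
    f : LinearEmbedding q n
    f = restrIso-embedding {M = M} {F = H} {Q = Q} iso

    e∉f : ∀ v → to f v ≢ e
    e∉f v fv≡e with v ≟ᵥ 𝟎
    ... | yes refl = e≢𝟎 (trans (sym fv≡e) (linear-𝟎 (linear f)))
    ... | no v≢𝟎 with () ← trans (sym (subst (_∈ H) fv≡e (f-into v v≢𝟎))) e∉H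

    g : LinearEmbedding (suc q) n
    g = adjoin f e e∉f

    g-extends : Extends (restrict M g) Q
    g-extends v = sym (restrIso-ground {M = M} {F = H} {Q = Q} iso v)

    adjoined∉H : ∀ v → H (to g (true ∷ v)) ≡ false
    adjoined∉H v with H (to g (true ∷ v)) in ∈H
    ... | false = refl
    ... | true with x , _ , fx≡gv ← f-onto _ ∈H with () ← injective g {false ∷ x} {true ∷ v} fx≡gv

    H⊆g : ∀ y → y ∈ H → y ∈ image g
    H⊆g y y∈H with x , x≢𝟎 , refl ← f-onto y y∈H = image-complete g {false ∷ x} (x≢𝟎 ∘ cong tail)

    g-onto : ∀ y → y ≢ 𝟎 → y ∈ image g
    g-onto = hyperplane-maximal H-hyperplane (image-isFlat g) H⊆g
      (image-complete g {true ∷ 𝟎} (λ ())) (adjoined∉H 𝟎)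

    g-outside≤outside : outside₀ (restrict M g) ≤ outside M H
    g-outside≤outside =
      count-mono-injective {S = E (restrict M g) ∘ (true ∷_)} (λ v → to g (true ∷ v))
        (λ {v} {w} gv≡gw → cong tail (injective g {true ∷ v} {true ∷ w} gv≡gw))
        (λ v v∈E → cong₂ _∧_ v∈E (cong not (adjoined∉H v)))

    g-positive : 0 < outside M H → 0 < outside₀ (restrict M g)
    g-positive pos with y , y∈E-H ← count-pos⁻ _ pos with y∈E , y∉H ← ∧-not≡true {E M y} y∈E-H
      with image-sound g (g-onto y (∈E⇒≢𝟎 M y∈E))
    ... | true ∷ v , _ , refl = count-pos (E (restrict M g) ∘ (true ∷_)) y∈E
    ... | false ∷ v , v≢𝟎 , refl with () ← trans (sym (f-into v (v≢𝟎 ∘ cong (false ∷_)))) y∉H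

E-D : ∀ {q} (Q : Matroid q) b v → E (D Q) (b ∷ v) ≡ E Q v
E-D Q false v = refl
E-D Q true v = refl

LinearForm : ∀ {q} → (V q → Bool) → Set
LinearForm φ = ∀ v w → φ (v ⊕ w) ≡ φ v xor φ w

graph : ∀ {q} (φ : V q → Bool) → LinearForm φ → LinearEmbedding q (suc (suc q))
graph φ φ-linear = record
  { to = λ v → false ∷ φ v ∷ v
  ; linear = λ v w → cong (λ b → false ∷ b ∷ (v ⊕ w)) (φ-linear v w)
  ; injective = cong (tail ∘ tail)
  }

sheet : ∀ {q} (φ : V q → Bool) → LinearForm φ → Bool → LinearEmbedding (suc q) (suc (suc q))
sheet φ φ-linear c = adjoin (graph φ φ-linear) (true ∷ c ∷ 𝟎) λ _ ()

module Sheets {P : ∀ n → Matroid n → Set} (hereditary : Hereditary P) {q} {Q : Matroid q} {s}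
  (bound : ExtensionBound P Q s) {M : Matroid (suc (suc q))} (M∈P : P _ M) (M-extends : Extends M (D Q)) where

  slice : Bool → Subset q
  slice b v = E M (true ∷ b ∷ v)

  coset : (V q → Bool) → Bool → ℕ
  coset φ c = count (λ v → slice (φ v xor c) v)

  coset-sum : ∀ φ → coset φ false + coset φ true ≡ outside₀ M
  coset-sum φ = begin
    coset φ false + coset φ true
      ≡⟨ count-∨-∧ (λ v → slice (φ v xor false) v) (λ v → slice (φ v xor true) v) ⟩
    count (λ v → slice (φ v xor false) v ∨ slice (φ v xor true) v)
      + count (λ v → slice (φ v xor false) v ∧ slice (φ v xor true) v)
      ≡⟨ cong₂ _+_ (count-cong λ v → both-∨ (λ b → slice b v) (φ v))
                   (count-cong λ v → both-∧ (λ b → slice b v) (φ v)) ⟩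
    count (λ v → slice false v ∨ slice true v) + count (λ v → slice false v ∧ slice true v)
      ≡⟨ count-∨-∧ (slice false) (slice true) ⟨
    count (slice false) + count (slice true)
      ≡⟨ count-split (λ w → E M (true ∷ w)) ⟨
    outside₀ M ∎
    where
    open ≡-Reasoning
    both-∨ : ∀ (p : Bool → Bool) b → p (b xor false) ∨ p (b xor true) ≡ p false ∨ p true
    both-∨ p false = refl
    both-∨ p true = ∨-comm (p true) (p false)
    both-∧ : ∀ (p : Bool → Bool) b → p (b xor false) ∧ p (b xor true) ≡ p false ∧ p true
    both-∧ p false = refl
    both-∧ p true = ∧-comm (p true) (p false)

  coset-bound : ∀ (φ : V q → Bool) (φ-linear : LinearForm φ) c → 0 < coset φ c → s < coset φ c
  coset-bound φ φ-linear c pos =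
    subst (s <_) outside₀-sheet
      (bound (restrict M σ) (restrict-∈ hereditary M∈P σ) σ-extends (subst (0 <_) (sym outside₀-sheet) pos))
    where
    σ = sheet φ φ-linear c
    σ-extends : Extends (restrict M σ) Q
    σ-extends v = trans (M-extends (φ v ∷ v)) (E-D Q (φ v) v)
    outside₀-sheet : outside₀ (restrict M σ) ≡ coset φ c
    outside₀-sheet = count-cong λ v → cong (λ w → E M (true ∷ (φ v xor c) ∷ w)) (⊕-identityʳ v)

double : ∀ {P : ∀ n → Matroid n → Set} {q} {Q : Matroid q} {s} → Hereditary P →
  ExtensionBound P Q s → ExtensionBound P (D Q) (s + s)
double {s = zero} _ _ _ _ _ pos = pos
double {q = q} {s = suc r} hereditary bound M M∈P M-extends pos
  with c ∷ u , u∈slice ← count-pos⁻ (λ w → E M (true ∷ w)) pos =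
  subst (suc r + suc r <_) (coset-sum φ)
    (+-mono-< (coset-bound φ φ-linear false (nonempty false)) (coset-bound φ φ-linear true (nonempty true)))
  where
  open Sheets hereditary bound M∈P M-extends

  2≤slice : 2 ≤ count (slice c)
  2≤slice = ≤-trans (s≤s (s≤s z≤n)) (coset-bound (λ _ → false) (λ _ _ → refl) c (count-pos (slice c) u∈slice))

  separator : Σ (Fin q) (Separates (slice c))
  separator = separating-coordinate (slice c) 2≤slice

  φ : V q → Bool
  φ v = lookup v (proj₁ separator)

  φ-linear : LinearForm φ
  φ-linear = lookup-zipWith _xor_ (proj₁ separator)

  nonempty : ∀ c′ → 0 < coset φ c′
  nonempty c′ with v , v∈slice , vᵢ≡c⊕c′ ← proj₂ separator (c xor c′) =
    count-pos (λ w → slice (φ w xor c′) w)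
      (subst (λ b → slice b v ≡ true) (trans (sym (xor-cancelʳ c c′)) (cong (_xor c′) (sym vᵢ≡c⊕c′))) v∈slice)

*-double : ∀ t x → t * x + t * x ≡ t * (2 * x)
*-double t x = begin
  t * x + t * x     ≡⟨ *-distribˡ-+ t x x ⟨
  t * (x + x)       ≡⟨ cong (λ y → t * (x + y)) (+-identityʳ x) ⟨
  t * (2 * x)       ∎
  where open ≡-Reasoning

mainTheorem9 : (P : ∀ n → Matroid n → Set) → Hereditary P →
    ∀ m (N : Matroid m) → P m N → (t : ℕ) →
    (∀ n (M : Matroid n) (H : Subset n) → P n M → IsHyperplane H →
      RestrIso M H N → 0 < outside M H → t < outside M H) →
    ∀ (k n : ℕ) (M : Matroid n) (H : Subset n) → P n M → IsHyperplane H →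
      RestrIso M H (Dᵏ k N) → 0 < outside M H → t * 2 ^ k < outside M H
mainTheorem9 P hereditary m N _ t N-bound k = extension⇒hyperplane {Q = Dᵏ k N} hereditary (bound k)
  where
  bound : ∀ k → ExtensionBound P (Dᵏ k N) (t * 2 ^ k)
  bound zero = subst (ExtensionBound P N) (sym (*-identityʳ t)) (hyperplane⇒extension {Q = N} N-bound)
  bound (suc k) = subst (ExtensionBound P (D (Dᵏ k N))) (*-double t (2 ^ k)) (double hereditary (bound k))
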